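{- Let $T$ be a decomposition tree and $v$ an internal node of $T$. Then $|\hat\gamma_k(v)-\hat\gamma_{k+1}(v)|=1$ for every $0\le k<|\hat{TS}(v)|$.
   Context: All graphs are finite, simple and undirected. For a graph $H$ and $S\subseteq V(H)$, $N_H[S]$ is the closed neighbourhood of $S$ in $H$ and $H[S]$ the induced subgraph; a graph with no vertices is regarded as having a (empty) perfect matching. A decomposition tree is a rooted tree $T$ in which every internal node has exactly two children, a left child $v_l$ and a right child $v_r$, and carries one of the labels $\otimes$ (true twin), $\odot$ (false twin), $\oplus$ (attachment). To each node $v$ are associated a graph $\hat G(v)$ and a twin set $\hat{TS}(v)\subseteq V(\hat G(v))$: for a leaf, $\hat G(v)$ is a single vertex $x$ (distinct leaves giving distinct vertices) and $\hat{TS}(v)=\{x\}$; for an internal node $v$, $V(\hat G(v))=V(\hat G(v_l))\cup V(\hat G(v_r))$ and: if $v$ is labeled $\otimes$, $E(\hat G(v))=E(\hat G(v_l))\cup E(\hat G(v_r))\cup\{xy: x\in \hat{TS}(v_l), y\in\hat{TS}(v_r)\}$ and $\hat{TS}(v)=\hat{TS}(v_l)\cup\hat{TS}(v_r)$; if labeled $\odot$, $E(\hat G(v))=E(\hat G(v_l))\cup E(\hat G(v_r))$ and $\hat{TS}(v)=\hat{TS}(v_l)\cup\hat{TS}(v_r)$; if labeled $\oplus$, the edge set is as for $\otimes$ and $\hat{TS}(v)=\hat{TS}(v_l)$. For $0\le k\le|\hat{TS}(v)|$, $\hat\gamma_k(v)$ is the minimum of $|S|$ over all $S\subseteq V(\hat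 G(v))$ with $V(\hat G(v))\setminus \hat{TS}(v)\subseteq N_{\hat G(v)}[S]$ for which there is $X\subseteq S\cap\hat{TS}(v)$, $|X|=k$, such that $\hat G(v)[S\setminus X]$ has a perfect matching. -}

module Defs where

open import Data.Nat using (ℕ; zero; suc; _≤_)
open import Data.Bool using (Bool; true; false; _∧_; not; if_then_else_; T)
open import Data.List using (List; []; _∷_; [_]; _++_; map)
open import Data.Nat.ListAction using (sum)
open import Data.Product using (Σ; ∃; _×_; _,_)
open import Data.Sum using (_⊎_)
open import Data.Empty using (⊥)
open import Relation.Binary.PropositionalEquality using (_≡_)

-- Node labels: ⊗ (true twin), ⊙ (false twin), ⊕ (attachment).
data Label : Set where
  ⊗ ⊙ ⊕ : Label

-- A decomposition tree (rooted, every internal node has a left and a right child).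
-- A tree here is the subtree rooted at a node v.
data Tree : Set where
  leaf : Tree
  node : Label → Tree → Tree → Tree

-- Vertices of Ĝ(v): the leaves of the subtree rooted at v (distinct leaves = distinct vertices).
data Vertex : Tree → Set where
  here  : Vertex leaf
  left  : ∀ {a l r} → Vertex l → Vertex (node a l r)
  right : ∀ {a l r} → Vertex r → Vertex (node a l r)

allVertices : (t : Tree) → List (Vertex t)
allVertices leaf = [ here ]
allVertices (node a l r) = map left (allVertices l) ++ map right (allVertices r)

Sub : Tree → Set
Sub t = Vertex t → Bool

card : {t : Tree} → Sub t → ℕ
card {t} S = sum (map (λ x → if S x then 1 else 0) (allVertices t))

TS : (t : Tree) → Sub t
TS leaf here = true
TS (node ⊗ l r) (left x) = TS l x
TS (node ⊗ l r) (right y) = TS r y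
TS (node ⊙ l r) (left x) = TS l x
TS (node ⊙ l r) (right y) = TS r y
TS (node ⊕ l r) (left x) = TS l x
TS (node ⊕ l r) (right y) = false

cross : Label → (l r : Tree) → Vertex l → Vertex r → Set
cross ⊗ l r x y = T (TS l x ∧ TS r y)
cross ⊙ l r x y = ⊥
cross ⊕ l r x y = T (TS l x ∧ TS r y)

Adj : (t : Tree) → Vertex t → Vertex t → Set
Adj leaf here here = ⊥
Adj (node a l r) (left x)  (left y)  = Adj l x y
Adj (node a l r) (right x) (right y) = Adj r x y
Adj (node a l r) (left x)  (right y) = cross a l r x y
Adj (node a l r) (right y) (left x)  = cross a l r x y

Dominates : (t : Tree) → Sub t → Set
Dominates t S = ∀ u → T (not (TS t u)) → T (S u) ⊎ (∃ λ w → T (S w) × Adj t w u)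

HasPerfectMatching : (t : Tree) → Sub t → Set₁
HasPerfectMatching t A =
  Σ (Vertex t → Vertex t → Set) λ M →
    (∀ u w → M u w → Adj t u w × T (A u) × T (A w)) ×
    (∀ u w → M u w → M w u) ×
    (∀ u → T (A u) → ∃ λ w → M u w × (∀ w' → M u w' → w' ≡ w))

Feasible : (t : Tree) → ℕ → Sub t → Set₁
Feasible t k S =
  Dominates t S ×
  Σ (Sub t) λ X →
    (∀ u → T (X u) → T (S u ∧ TS t u)) ×
    card X ≡ k ×
    HasPerfectMatching t (λ u → S u ∧ not (X u))

IsGammaHat : (t : Tree) → ℕ → ℕ → Set₁
IsGammaHat t k g =
  (Σ (Sub t) λ S → Feasible t k S × card S ≡ g) ×
  (∀ S → Feasible t k S → g ≤ card S)

module Submission where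

-- A feasible S comes with X and a perfect matching of S ∖ X, so |S| = k + 2m: γ̂_k and
-- γ̂_{k+1} have opposite parities, and it suffices that each is at most one more than the
-- other. A twin outside S simply joins S and X; moving a twin of S into or out of X instead
-- leaves one vertex w of S unmatched. Then w is matched to a neighbour outside S or, if all
-- its neighbours already lie in S, deleted, so |S| changes by exactly one. Deleting keeps
-- domination because every vertex outside T̂S has a neighbour. Feasible sets exist for every
-- k (greedily for k = |T̂S|, then downwards), and the minimum is attained because feasibility
-- of a given size is decidable.

open import Defs
open import Data.Bool using (Bool; true; false; _∧_; not; if_then_else_; T)
open import Data.Bool.Properties using (T-∧; T-≡; T-not-≡; ∧-zeroʳ; ∧-identityʳ)
open import Data.Empty using (⊥-elim)
open import Data.List using (List; []; _∷_; _++_; map)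
open import Data.List.Membership.Propositional using (_∈_)
open import Data.List.Membership.Propositional.Properties using (∈-map⁺; ∈-++⁺ˡ; ∈-++⁺ʳ)
open import Data.List.Properties using (map-++; map-∘; map-cong)
open import Data.List.Relation.Unary.All as All using (All; []; _∷_)
import Data.List.Relation.Unary.Any as Any
open import Data.Nat using (ℕ; zero; suc; _+_; _∸_; _*_; _≤_; _<_; z≤n; s≤s; ∣_-_∣)
import Data.Nat as ℕ
open import Data.Nat.ListAction using (sum)
open import Data.Nat.ListAction.Properties using (sum-++)
open import Data.Nat.Properties
  using (+-assoc; +-suc; *-suc; +-cancelˡ-≡; suc-injective; m∸n+n≡m; even≢odd; +-commutativeSemigroup;
         ≤-refl; ≤-reflexive; ≤-trans; +-mono-≤; m≤n+m; <⇒≤; <⇒≱; ≮⇒≥; m<1+n⇒m<n∨m≡n)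
open import Algebra.Properties.CommutativeSemigroup +-commutativeSemigroup using (interchange; x∙yz≈y∙xz)
open import Data.Product using (∃; ∃₂; _×_; _,_; proj₁; proj₂)
open import Data.Sum using (_⊎_; inj₁; inj₂; [_,_])
open import Data.Unit using (tt)
open import Function using (_∘_; _$_; id; const; Equivalence)
open import Relation.Binary.Definitions using (_Respects_)
open import Relation.Binary.PropositionalEquality
  using (_≡_; _≢_; _≗_; refl; sym; trans; cong; cong₂; subst; module ≡-Reasoning)
open import Relation.Nullary using (Dec; yes; no; ¬_; does)
open import Relation.Nullary.Decidable using (map′; decidable-stable; ¬?; T?; _×-dec_; _⊎-dec_; _→-dec_)
open import Relation.Unary using (Decidable)

variable
  t : Tree

left-injective : ∀ {a l r} {x y : Vertex l} → left {a} {l} {r} x ≡ left y → x ≡ y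
left-injective refl = refl

right-injective : ∀ {a l r} {x y : Vertex r} → right {a} {l} {r} x ≡ right y → x ≡ y
right-injective refl = refl

-- Built with map′ so that does (left x ≟ left y) reduces to does (x ≟ y); the cardinality
-- lemmas below rely on update commuting with left and right definitionally.
_≟_ : (x y : Vertex t) → Dec (x ≡ y)
here    ≟ here    = yes refl
left x  ≟ left y  = map′ (cong left) left-injective (x ≟ y)
left _  ≟ right _ = no λ ()
right _ ≟ left _  = no λ ()
right x ≟ right y = map′ (cong right) right-injective (x ≟ y)

Searchable : Set → Set₁
Searchable A = (P : A → Set) → Decidable P → Dec (∃ P)

any? : ∀ t → Searchable (Vertex t)
any? leaf P P? = map′ (here ,_) (λ { (here , p) → p }) (P? here)
any? (node a l r) P P? =
  map′ [ (λ (x , p) → left x , p) , (λ (y , p) → right y , p) ] side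
       (any? l (P ∘ left) (P? ∘ left) ⊎-dec any? r (P ∘ right) (P? ∘ right))
  where
  side : ∃ P → ∃ (P ∘ left) ⊎ ∃ (P ∘ right)
  side (left x , p)  = inj₁ (x , p)
  side (right y , p) = inj₂ (y , p)

all? : ∀ t (P : Vertex t → Set) → Decidable P → Dec (∀ u → P u)
all? leaf P P? = map′ (λ { p here → p }) (_$ here) (P? here)
all? (node a l r) P P? =
  map′ (λ { (pl , pr) (left x) → pl x ; (pl , pr) (right y) → pr y }) (λ p → p ∘ left , p ∘ right)
       (all? l (P ∘ left) (P? ∘ left) ×-dec all? r (P ∘ right) (P? ∘ right))

Bool-searchable : Searchable Bool
Bool-searchable P P? =
  map′ [ (true ,_) , (false ,_) ] (λ { (true , p) → inj₁ p ; (false , p) → inj₂ p })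
       (P? true ⊎-dec P? false)

×-searchable : ∀ {A B} → Searchable A → Searchable B → Searchable (A × B)
×-searchable sA sB P P? =
  map′ (λ (a , b , p) → (a , b) , p) (λ ((a , b) , p) → a , b , p)
       (sA (λ a → ∃ λ b → P (a , b)) (λ a → sB (λ b → P (a , b)) (λ b → P? (a , b))))

Π-searchable : ∀ {B} → Searchable B → ∀ t (P : (Vertex t → B) → Set) →
               P Respects _≗_ → Decidable P → Dec (∃ P)
Π-searchable sB leaf P resp P? =
  map′ (λ (b , p) → const b , p) (λ (f , p) → f here , resp (λ { here → refl }) p)
       (sB (P ∘ const) (P? ∘ const))
Π-searchable {B} sB (node a l r) P resp P? =
  map′ (λ (fl , fr , p) → join fl fr , p)
       (λ (f , p) → f ∘ left , f ∘ right , resp (λ { (left x) → refl ; (right y) → refl }) p)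
       (Π-searchable sB l Q Q-resp Q?)
  where
  join : (Vertex l → B) → (Vertex r → B) → Vertex (node a l r) → B
  join fl fr (left x)  = fl x
  join fl fr (right y) = fr y
  Q : (Vertex l → B) → Set
  Q fl = ∃ λ fr → P (join fl fr)
  Q-resp : Q Respects _≗_
  Q-resp eq (fr , p) = fr , resp (λ { (left x) → eq x ; (right y) → refl }) p
  Q? : Decidable Q
  Q? fl = Π-searchable sB r (P ∘ join fl) (λ eq → resp (λ { (left x) → refl ; (right y) → eq y }))
                       (P? ∘ join fl)

-- The graph Ĝ(v)

Adj-sym : ∀ t {u w} → Adj t u w → Adj t w u
Adj-sym leaf {here} {here} ()
Adj-sym (node a l r) {left x}  {left y}  = Adj-sym l
Adj-sym (node a l r) {right x} {right y} = Adj-sym r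
Adj-sym (node a l r) {left x}  {right y} e = e
Adj-sym (node a l r) {right x} {left y}  e = e

Adj-irrefl : ∀ t {u} → ¬ Adj t u u
Adj-irrefl leaf {here} ()
Adj-irrefl (node a l r) {left x}  = Adj-irrefl l
Adj-irrefl (node a l r) {right x} = Adj-irrefl r

Adj⇒≢ : ∀ {u w} → Adj t u w → u ≢ w
Adj⇒≢ {t} e refl = Adj-irrefl t e

cross? : ∀ a l r x y → Dec (cross a l r x y)
cross? ⊗ l r x y = T? _
cross? ⊙ l r x y = no λ ()
cross? ⊕ l r x y = T? _

Adj? : ∀ t u w → Dec (Adj t u w)
Adj? leaf here here = no λ ()
Adj? (node a l r) (left x)  (left y)  = Adj? l x y
Adj? (node a l r) (right x) (right y) = Adj? r x y
Adj? (node a l r) (left x)  (right y) = cross? a l r x y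
Adj? (node a l r) (right x) (left y)  = cross? a l r y x

TS-nonempty : ∀ t → ∃ λ u → T (TS t u)
TS-nonempty leaf = here , tt
TS-nonempty (node ⊗ l r) = let (u , TSu) = TS-nonempty l in left u , TSu
TS-nonempty (node ⊙ l r) = let (u , TSu) = TS-nonempty l in left u , TSu
TS-nonempty (node ⊕ l r) = let (u , TSu) = TS-nonempty l in left u , TSu

non-twin-has-neighbour : ∀ t u → T (not (TS t u)) → ∃ λ w → Adj t w u
non-twin-has-neighbour leaf here ()
non-twin-has-neighbour (node ⊗ l r) (left x) h =
  let (w , wx) = non-twin-has-neighbour l x h in left w , wx
non-twin-has-neighbour (node ⊙ l r) (left x) h =
  let (w , wx) = non-twin-has-neighbour l x h in left w , wx
non-twin-has-neighbour (node ⊕ l r) (left x) h =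
  let (w , wx) = non-twin-has-neighbour l x h in left w , wx
non-twin-has-neighbour (node ⊗ l r) (right y) h =
  let (w , wy) = non-twin-has-neighbour r y h in right w , wy
non-twin-has-neighbour (node ⊙ l r) (right y) h =
  let (w , wy) = non-twin-has-neighbour r y h in right w , wy
non-twin-has-neighbour (node ⊕ l r) (right y) _ with TS r y in TSy
... | true  = let (w , TSw) = TS-nonempty l in left w , Equivalence.from T-∧ (TSw , subst T (sym TSy) tt)
... | false = let (w , wy) = non-twin-has-neighbour r y (subst (T ∘ not) (sym TSy) tt) in right w , wy

¬T⇒≡false : ∀ {b} → ¬ T b → b ≡ false
¬T⇒≡false {false} _  = refl
¬T⇒≡false {true}  ¬t = ⊥-elim (¬t tt)

infixl 7 _∩_
infixl 6 _∖_
infix  4 _⊆_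

_∩_ _∖_ : Sub t → Sub t → Sub t
(A ∩ B) u = A u ∧ B u
(A ∖ B) u = A u ∧ not (B u)

_⊆_ : Sub t → Sub t → Set
A ⊆ B = ∀ u → T (A u) → T (B u)

⊆-trans : {A B C : Sub t} → A ⊆ B → B ⊆ C → A ⊆ C
⊆-trans A⊆B B⊆C u = B⊆C u ∘ A⊆B u

⊆? : ∀ t (A B : Sub t) → Dec (A ⊆ B)
⊆? t A B = all? t _ λ u → T? (A u) →-dec T? (B u)

⊆-∩⁺ : {A B C : Sub t} → A ⊆ B → A ⊆ C → A ⊆ B ∩ C
⊆-∩⁺ A⊆B A⊆C u Au = Equivalence.from T-∧ (A⊆B u Au , A⊆C u Au)

⊆-∩⁻ˡ : {A B C : Sub t} → A ⊆ B ∩ C → A ⊆ B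
⊆-∩⁻ˡ A⊆B∩C u = proj₁ ∘ Equivalence.to T-∧ ∘ A⊆B∩C u

⊆-∩⁻ʳ : {A B C : Sub t} → A ⊆ B ∩ C → A ⊆ C
⊆-∩⁻ʳ A⊆B∩C u = proj₂ ∘ Equivalence.to T-∧ ∘ A⊆B∩C u

∩-absorbs : {A B : Sub t} → A ⊆ B → B ∩ A ≗ A
∩-absorbs {A = A} {B} A⊆B u with A u in Au
... | false = ∧-zeroʳ (B u)
... | true  = trans (∧-identityʳ (B u)) (Equivalence.to T-≡ (A⊆B u (subst T (sym Au) tt)))

∖-⊆ : (A B : Sub t) → A ∖ B ⊆ A
∖-⊆ A B u = proj₁ ∘ Equivalence.to T-∧

∈-∖⁺ : ∀ {A B : Sub t} {u} → T (A u) → ¬ T (B u) → T ((A ∖ B) u)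
∈-∖⁺ Au ¬Bu = Equivalence.from T-∧ (Au , Equivalence.from T-not-≡ (¬T⇒≡false ¬Bu))

∈-∖⁻ : ∀ {A B : Sub t} {u} → T ((A ∖ B) u) → ¬ T (B u)
∈-∖⁻ {A = A} {B} {u} u∈ Bu with A u | B u
... | false | _     = u∈
... | true  | true  = u∈
... | true  | false = Bu

update : Sub t → Vertex t → Bool → Sub t
update S y b u = if does (u ≟ y) then b else S u

insert remove : Vertex t → Sub t → Sub t
insert y S = update S y true
remove y S = update S y false

update-cong : ∀ {A B : Sub t} y b → A ≗ B → update A y b ≗ update B y b
update-cong y b A≗B u = cong (if does (u ≟ y) then b else_) (A≗B u)

module _ (y : Vertex t) (S : Sub t) where

  update-≡ : ∀ b → update S y b y ≡ b
  update-≡ b with y ≟ y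
  ... | yes _  = refl
  ... | no y≢y = ⊥-elim (y≢y refl)

  update-≢ : ∀ {b u} → u ≢ y → update S y b u ≡ S u
  update-≢ {u = u} u≢y with u ≟ y
  ... | yes u≡y = ⊥-elim (u≢y u≡y)
  ... | no _    = refl

  insert-∋ : T (insert y S y)
  insert-∋ = subst T (sym (update-≡ true)) tt

  ⊆-insert : S ⊆ insert y S
  ⊆-insert u Su with u ≟ y
  ... | yes _ = tt
  ... | no _  = Su

  ∈-insert⁻ : ∀ {u} → u ≢ y → T (insert y S u) → T (S u)
  ∈-insert⁻ u≢y = subst T (update-≢ u≢y)

  ∉-remove : ¬ T (remove y S y)
  ∉-remove = subst T (update-≡ false)

  remove-⊆ : remove y S ⊆ S
  remove-⊆ u h with u ≟ y
  ... | no _ = h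

  ∈-remove⁺ : ∀ {u} → u ≢ y → T (S u) → T (remove y S u)
  ∈-remove⁺ u≢y = subst T (sym (update-≢ u≢y))

  ∈-remove⁻ : ∀ {u} → T (remove y S u) → u ≢ y
  ∈-remove⁻ h refl = ∉-remove h

  ⊆-insert-remove : S ⊆ insert y (remove y S)
  ⊆-insert-remove u Su with u ≟ y
  ... | yes _ = tt
  ... | no _  = Su

insert-⊆ : ∀ {A B : Sub t} {y} → T (B y) → A ⊆ B → insert y A ⊆ B
insert-⊆ {y = y} By A⊆B u u∈ with u ≟ y
... | yes refl = By
... | no _     = A⊆B u u∈

⊆-remove : ∀ {A B : Sub t} {y} → ¬ T (A y) → A ⊆ B → A ⊆ remove y B
⊆-remove {B = B} {y} ¬Ay A⊆B u Au = ∈-remove⁺ y B (λ { refl → ¬Ay Au }) (A⊆B u Au)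

insert-∖ : ∀ {S X : Sub t} y → ¬ T (X y) → insert y S ∖ X ≗ insert y (S ∖ X)
insert-∖ y ¬Xy u with u ≟ y
... | yes refl = cong not (¬T⇒≡false ¬Xy)
... | no _     = refl

insert-∖-insert : ∀ {S X : Sub t} {y} → ¬ T (S y) → insert y S ∖ insert y X ≗ S ∖ X
insert-∖-insert {S = S} {X} {y} ¬Sy u with u ≟ y
... | yes refl = sym (cong (_∧ not (X u)) (¬T⇒≡false ¬Sy))
... | no _     = refl

remove-∖-remove : ∀ {S X : Sub t} {x} → T (X x) → remove x S ∖ remove x X ≗ S ∖ X
remove-∖-remove {S = S} {X} {x} Xx u with u ≟ x
... | yes refl = sym (trans (cong (λ b → S u ∧ not b) (Equivalence.to T-≡ Xx)) (∧-zeroʳ (S u)))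
... | no _     = refl

remove-∖-insert : ∀ {S X : Sub t} w u → remove w S ∖ insert u X ≗ remove w (remove u (S ∖ X))
remove-∖-insert {S = S} w u v with v ≟ w | v ≟ u
... | yes _ | _     = refl
... | no _  | yes _ = ∧-zeroʳ (S v)
... | no _  | no _  = refl

indicator : Bool → ℕ
indicator b = if b then 1 else 0

card-node : ∀ {a l r} (S : Sub (node a l r)) → card S ≡ card (S ∘ left) + card (S ∘ right)
card-node {l = l} {r} S = begin
  sum (map f (Lˡ ++ Lʳ))                        ≡⟨ cong sum (map-++ f Lˡ Lʳ) ⟩
  sum (map f Lˡ ++ map f Lʳ)                    ≡⟨ sum-++ (map f Lˡ) (map f Lʳ) ⟩
  sum (map f Lˡ) + sum (map f Lʳ)               ≡⟨ cong₂ _+_ (cong sum (map-∘ (allVertices l)))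
                                                            (cong sum (map-∘ (allVertices r))) ⟨
  card (S ∘ left) + card (S ∘ right)            ∎
  where
  open ≡-Reasoning
  f  = indicator ∘ S
  Lˡ = map left (allVertices l)
  Lʳ = map right (allVertices r)

card-cong : {A B : Sub t} → A ≗ B → card A ≡ card B
card-cong {t} A≗B = cong sum (map-cong (cong indicator ∘ A≗B) (allVertices t))

card-mono : ∀ t {A B : Sub t} → A ⊆ B → card A ≤ card B
card-mono leaf {A} {B} A⊆B = leaf-case (A here) (B here) (A⊆B here)
  where
  leaf-case : ∀ a b → (T a → T b) → indicator a + 0 ≤ indicator b + 0
  leaf-case false _     _ = z≤n
  leaf-case true  true  _ = ≤-refl
  leaf-case true  false f = ⊥-elim (f tt)
card-mono (node a l r) {A} {B} A⊆B rewrite card-node A | card-node B =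
  +-mono-≤ (card-mono l (A⊆B ∘ left)) (card-mono r (A⊆B ∘ right))

card-empty : ∀ t {A : Sub t} → (∀ u → ¬ T (A u)) → card A ≡ 0
card-empty leaf {A} ∅ with A here in Ah
... | true  = ⊥-elim (∅ here (subst T (sym Ah) tt))
... | false = refl
card-empty (node a l r) {A} ∅ rewrite card-node A
  | card-empty l (∅ ∘ left) | card-empty r (∅ ∘ right) = refl

card-suc⇒nonempty : ∀ t {A : Sub t} {n} → card A ≡ suc n → ∃ (T ∘ A)
card-suc⇒nonempty t {A} |A|≡1+n with any? t (T ∘ A) (T? ∘ A)
... | yes a  = a
... | no  ∄a with () ← trans (sym |A|≡1+n) (card-empty t (λ u Au → ∄a (u , Au)))

card-remove-split : ∀ t (S : Sub t) y → card S ≡ indicator (S y) + card (remove y S)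
card-remove-split leaf S here = refl
card-remove-split (node a l r) S (left y) = begin
  card S                                 ≡⟨ card-node S ⟩
  card Sˡ + card Sʳ                      ≡⟨ cong (_+ card Sʳ) (card-remove-split l Sˡ y) ⟩
  i + card (remove y Sˡ) + card Sʳ       ≡⟨ +-assoc i (card (remove y Sˡ)) (card Sʳ) ⟩
  i + (card (remove y Sˡ) + card Sʳ)     ≡⟨ cong (i +_) (card-node {l = l} {r} (remove (left y) S)) ⟨
  i + card (remove (left y) S)           ∎
  where
  open ≡-Reasoning
  Sˡ = S ∘ left
  Sʳ = S ∘ right
  i  = indicator (S (left y))
card-remove-split (node a l r) S (right y) = begin
  card S                                 ≡⟨ card-node S ⟩
  card Sˡ + card Sʳ                      ≡⟨ cong (card Sˡ +_) (card-remove-split r Sʳ y) ⟩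
  card Sˡ + (i + card (remove y Sʳ))     ≡⟨ x∙yz≈y∙xz (card Sˡ) i (card (remove y Sʳ)) ⟩
  i + (card Sˡ + card (remove y Sʳ))     ≡⟨ cong (i +_) (card-node {l = l} {r} (remove (right y) S)) ⟨
  i + card (remove (right y) S)          ∎
  where
  open ≡-Reasoning
  Sˡ = S ∘ left
  Sʳ = S ∘ right
  i  = indicator (S (right y))

card-remove : ∀ y (S : Sub t) → T (S y) → card S ≡ suc (card (remove y S))
card-remove {t} y S Sy =
  trans (card-remove-split t S y) (cong (λ b → indicator b + card (remove y S)) (Equivalence.to T-≡ Sy))

card-insert : ∀ y (S : Sub t) → ¬ T (S y) → card (insert y S) ≡ suc (card S)
card-insert {t} y S ¬Sy = begin
  card (insert y S)                          ≡⟨ card-remove y (insert y S) (insert-∋ y S) ⟩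
  suc (card (remove y (insert y S)))         ≡⟨ cong suc (card-cong remove-insert) ⟩
  suc (indicator false + card (remove y S))  ≡⟨ cong (λ b → suc (indicator b + card (remove y S)))
                                                     (¬T⇒≡false ¬Sy) ⟨
  suc (indicator (S y) + card (remove y S))  ≡⟨ cong suc (card-remove-split t S y) ⟨
  suc (card S)                               ∎
  where
  open ≡-Reasoning
  remove-insert : remove y (insert y S) ≗ remove y S
  remove-insert u with u ≟ y
  ... | yes _ = refl
  ... | no _  = refl

card-∩-∖ : ∀ t (A B : Sub t) → card A ≡ card (A ∩ B) + card (A ∖ B)
card-∩-∖ leaf A B with A here | B here
... | false | _     = refl
... | true  | false = refl
... | true  | true  = refl
card-∩-∖ (node a l r) A B = begin
  card A
    ≡⟨ card-node A ⟩
  card Aˡ + card Aʳ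
    ≡⟨ cong₂ _+_ (card-∩-∖ l Aˡ Bˡ) (card-∩-∖ r Aʳ Bʳ) ⟩
  (card (Aˡ ∩ Bˡ) + card (Aˡ ∖ Bˡ)) + (card (Aʳ ∩ Bʳ) + card (Aʳ ∖ Bʳ))
    ≡⟨ interchange (card (Aˡ ∩ Bˡ)) (card (Aˡ ∖ Bˡ)) (card (Aʳ ∩ Bʳ)) (card (Aʳ ∖ Bʳ)) ⟩
  (card (Aˡ ∩ Bˡ) + card (Aʳ ∩ Bʳ)) + (card (Aˡ ∖ Bˡ) + card (Aʳ ∖ Bʳ))
    ≡⟨ cong₂ _+_ (card-node (A ∩ B)) (card-node (A ∖ B)) ⟨
  card (A ∩ B) + card (A ∖ B)
    ∎
  where
  open ≡-Reasoning
  Aˡ = A ∘ left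
  Aʳ = A ∘ right
  Bˡ = B ∘ left
  Bʳ = B ∘ right

-- Perfect matchings

record Matched (t : Tree) (A : Sub t) (p : Vertex t → Vertex t) (u : Vertex t) : Set where
  constructor matched
  field
    adjacent   : Adj t u (p u)
    partner∈   : T (A (p u))
    involutive : p (p u) ≡ u

-- The matching of Ĝ(v)[A] is given by the partner function p; its values off A are irrelevant.
PerfectMatching : (t : Tree) → Sub t → (Vertex t → Vertex t) → Set
PerfectMatching t A p = ∀ u → T (A u) → Matched t A p u

matched-via : ∀ {A : Sub t} {p u w} → p u ≡ w → Adj t u w → T (A w) → p w ≡ u → Matched t A p u
matched-via refl = matched

matching-cong : ∀ {A B : Sub t} {p q} → A ≗ B → p ≗ q → PerfectMatching t A p → PerfectMatching t B q
matching-cong {t} {A} {B} {p} {q} A≗B p≗q pm u Bu =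
  matched-via (sym (p≗q u)) adjacent (subst T (A≗B (p u)) partner∈) (trans (sym (p≗q (p u))) involutive)
  where open Matched (pm u (subst T (sym (A≗B u)) Bu))

hasPerfectMatching⇒partner : ∀ {A : Sub t} → HasPerfectMatching t A → ∃ (PerfectMatching t A)
hasPerfectMatching⇒partner {t} {A} (M , M⊆E , M-sym , unique) = p , pm
  where
  ifT : (b : Bool) → (T b → Vertex t) → Vertex t → Vertex t
  ifT true  f _ = f tt
  ifT false _ d = d
  ifT-true : ∀ b f d (h : T b) → ifT b f d ≡ f h
  ifT-true true f d tt = refl
  p : Vertex t → Vertex t
  p u = ifT (A u) (λ Au → proj₁ (unique u Au)) u
  p-spec : ∀ u (Au : T (A u)) → p u ≡ proj₁ (unique u Au)
  p-spec u = ifT-true (A u) (λ Au → proj₁ (unique u Au)) u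
  pm : PerfectMatching t A p
  pm u Au =
    let (w , Muw , _)        = unique u Au
        (uw , _ , Aw)        = M⊆E u w Muw
        (_ , _ , w-partner!) = unique w Aw
    in matched-via (p-spec u Au) uw Aw (trans (p-spec w Aw) (sym (w-partner! u (M-sym u w Muw))))

partner⇒hasPerfectMatching : ∀ {A : Sub t} → ∃ (PerfectMatching t A) → HasPerfectMatching t A
partner⇒hasPerfectMatching {t} {A} (p , pm) = M , M⊆E , M-sym , unique
  where
  M : Vertex t → Vertex t → Set
  M u w = T (A u) × p u ≡ w
  M⊆E : ∀ u w → M u w → Adj t u w × T (A u) × T (A w)
  M⊆E u _ (Au , refl) = let open Matched (pm u Au) in adjacent , Au , partner∈
  M-sym : ∀ u w → M u w → M w u
  M-sym u _ (Au , refl) = let open Matched (pm u Au) in partner∈ , involutive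
  unique : ∀ u → T (A u) → ∃ λ w → M u w × (∀ w' → M u w' → w' ≡ w)
  unique u Au = p u , (Au , refl) , λ { _ (_ , refl) → refl }

perfectMatching? : ∀ t (A : Sub t) p → Dec (PerfectMatching t A p)
perfectMatching? t A p = all? t _ λ u → T? (A u) →-dec
  map′ (λ (uv , A[pu] , ppu≡u) → matched uv A[pu] ppu≡u)
       (λ (matched uv A[pu] ppu≡u) → uv , A[pu] , ppu≡u)
       (Adj? t u (p u) ×-dec T? (A (p u)) ×-dec (p (p u) ≟ u))

link : Vertex t → Vertex t → (Vertex t → Vertex t) → Vertex t → Vertex t
link x y p u = if does (u ≟ x) then y else if does (u ≟ y) then x else p u

module _ {x y : Vertex t} {p : Vertex t → Vertex t} where

  link-x : link x y p x ≡ y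
  link-x with x ≟ x
  ... | yes _  = refl
  ... | no x≢x = ⊥-elim (x≢x refl)

  link-y : y ≢ x → link x y p y ≡ x
  link-y y≢x with y ≟ x | y ≟ y
  ... | yes y≡x | _      = ⊥-elim (y≢x y≡x)
  ... | no _    | yes _  = refl
  ... | no _    | no y≢y = ⊥-elim (y≢y refl)

  link-other : ∀ {u} → u ≢ x → u ≢ y → link x y p u ≡ p u
  link-other {u} u≢x u≢y with u ≟ x | u ≟ y
  ... | yes u≡x | _       = ⊥-elim (u≢x u≡x)
  ... | no _    | yes u≡y = ⊥-elim (u≢y u≡y)
  ... | no _    | no _    = refl

  matching-link : ∀ {A : Sub t} → PerfectMatching t A p → ¬ T (A x) → ¬ T (A y) → Adj t x y →
                  PerfectMatching t (insert y (insert x A)) (link x y p)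
  matching-link {A} pm ¬Ax ¬Ay xy u u∈ with u ≟ x | u ≟ y
  ... | yes refl | _        =
    matched-via link-x xy (insert-∋ y (insert x A)) (link-y (Adj⇒≢ xy ∘ sym))
  ... | no _     | yes refl =
    matched-via (link-y (Adj⇒≢ xy ∘ sym)) (Adj-sym t xy)
                (⊆-insert y (insert x A) x (insert-∋ x A)) link-x
  ... | no u≢x   | no u≢y   =
    matched-via (link-other u≢x u≢y) adjacent
                (⊆-insert y (insert x A) (p u) (⊆-insert x A (p u) partner∈))
                (trans (link-other (outside ¬Ax) (outside ¬Ay)) involutive)
    where
    open Matched (pm u u∈)
    outside : ∀ {z} → ¬ T (A z) → p u ≢ z
    outside ¬Az refl = ¬Az partner∈

matching-remove-pair : ∀ {A : Sub t} {p x} → PerfectMatching t A p → T (A x) →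
                       PerfectMatching t (remove (p x) (remove x A)) p
matching-remove-pair {t} {A} {p} {x} pm Ax u u∈ =
  matched adjacent
          (∈-remove⁺ (p x) (remove x A) (u≢x ∘ same-partner)
             (∈-remove⁺ x A (λ pu≡x → u≢px (trans (sym involutive) (cong p pu≡x))) partner∈))
          involutive
  where
  u≢px = ∈-remove⁻ (p x) (remove x A) u∈
  u≢x  = ∈-remove⁻ x A (remove-⊆ (p x) (remove x A) u u∈)
  open Matched (pm u (remove-⊆ x A u (remove-⊆ (p x) (remove x A) u u∈)))
  same-partner : p u ≡ p x → u ≡ x
  same-partner pu≡px = trans (sym involutive) (trans (cong p pu≡px) (Matched.involutive (pm x Ax)))

card-remove-pair : ∀ {A : Sub t} {p x} → PerfectMatching t A p → T (A x) →
                   card A ≡ 2 + card (remove (p x) (remove x A))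
card-remove-pair {t} {A} {p} {x} pm Ax =
  trans (card-remove x A Ax)
        (cong suc (card-remove (p x) (remove x A) (∈-remove⁺ x A (Adj⇒≢ adjacent ∘ sym) partner∈)))
  where open Matched (pm x Ax)

matching-card-even : ∀ {A : Sub t} {p} → PerfectMatching t A p → ∃ λ m → card A ≡ 2 * m
matching-card-even {t} {p = p} = by-size _ refl
  where
  by-size : ∀ n {A} → card A ≡ n → PerfectMatching t A p → ∃ λ m → card A ≡ 2 * m
  by-size zero          |A|≡0   _  = 0 , |A|≡0
  by-size (suc n)       |A|≡1+n pm with card-suc⇒nonempty t |A|≡1+n
  by-size (suc zero)    |A|≡1   pm | x , Ax with () ← trans (sym |A|≡1) (card-remove-pair pm Ax)
  by-size (suc (suc n)) |A|≡2+n pm | x , Ax =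
    let |A'|≡n = suc-injective (suc-injective (trans (sym (card-remove-pair pm Ax)) |A|≡2+n))
        (m , |A'|≡2m) = by-size n |A'|≡n (matching-remove-pair pm Ax)
    in suc m , trans (card-remove-pair pm Ax) (trans (cong (2 +_) |A'|≡2m) (sym (*-suc 2 m)))

DominatedAt : (t : Tree) → Sub t → Vertex t → Set
DominatedAt t S u = T (not (TS t u)) → T (S u) ⊎ ∃ λ w → T (S w) × Adj t w u

dominatedAt-mono : ∀ {S S' : Sub t} {u} → S ⊆ S' → DominatedAt t S u → DominatedAt t S' u
dominatedAt-mono S⊆S' D ¬TSu =
  [ inj₁ ∘ S⊆S' _ , (λ (w , Sw , wu) → inj₂ (w , S⊆S' w Sw , wu)) ] (D ¬TSu)

dominates? : ∀ t (S : Sub t) → Dec (Dominates t S)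
dominates? t S = all? t _ λ u →
  T? (not (TS t u)) →-dec (T? (S u) ⊎-dec any? t _ (λ w → T? (S w) ×-dec Adj? t w u))

-- Feasible with the matching given by a partner function, which makes it decidable.
record IsSolution (t : Tree) (k : ℕ) (S X : Sub t) (p : Vertex t → Vertex t) : Set where
  field
    dominates : Dominates t S
    X⊆S       : X ⊆ S
    X⊆TS      : X ⊆ TS t
    card-X    : card X ≡ k
    matching  : PerfectMatching t (S ∖ X) p

Solution : (t : Tree) → ℕ → Sub t → Set
Solution t k S = ∃₂ λ X p → IsSolution t k S X p

feasible⇒solution : ∀ {k S} → Feasible t k S → Solution t k S
feasible⇒solution (dom , X , X⊆S∩TS , card-X , hpm) =
  let (p , pm) = hasPerfectMatching⇒partner hpm
  in X , p , record { dominates = dom ; X⊆S = ⊆-∩⁻ˡ X⊆S∩TS ; X⊆TS = ⊆-∩⁻ʳ X⊆S∩TS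
                    ; card-X = card-X ; matching = pm }

solution⇒feasible : ∀ {k S} → Solution t k S → Feasible t k S
solution⇒feasible (X , p , sol) =
  dominates , X , ⊆-∩⁺ X⊆S X⊆TS , card-X , partner⇒hasPerfectMatching (p , matching)
  where open IsSolution sol

isSolution? : ∀ t k S X p → Dec (IsSolution t k S X p)
isSolution? t k S X p =
  map′ (λ (dom , X⊆S , X⊆TS , |X| , pm) →
          record { dominates = dom ; X⊆S = X⊆S ; X⊆TS = X⊆TS ; card-X = |X| ; matching = pm })
       (λ sol → let open IsSolution sol in dominates , X⊆S , X⊆TS , card-X , matching)
       (dominates? t S ×-dec ⊆? t X S ×-dec ⊆? t X (TS t) ×-dec card X ℕ.≟ k ×-dec
        perfectMatching? t (S ∖ X) p)

isSolution-cong : ∀ {k S S' X X' p p'} → S ≗ S' → X ≗ X' → p ≗ p' →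
                  IsSolution t k S X p → IsSolution t k S' X' p'
isSolution-cong {S = S} {S'} {X} {X'} S≗S' X≗X' p≗p' sol = record
  { dominates = λ u → dominatedAt-mono S⊆S' (dominates u)
  ; X⊆S       = λ u → S⊆S' u ∘ X⊆S u ∘ X'⊆X u
  ; X⊆TS      = λ u → X⊆TS u ∘ X'⊆X u
  ; card-X    = trans (card-cong (sym ∘ X≗X')) card-X
  ; matching  = matching-cong (λ u → cong₂ (λ s x → s ∧ not x) (S≗S' u) (X≗X' u)) p≗p' matching
  }
  where
  open IsSolution sol
  S⊆S' : S ⊆ S'
  S⊆S' u = subst T (S≗S' u)
  X'⊆X : X' ⊆ X
  X'⊆X u = subst T (sym (X≗X' u))

solution-of-size? : ∀ t k n → Dec (∃ λ S → Solution t k S × card S ≡ n)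
solution-of-size? t k n =
  map′ (λ (f , sol , |S|) → S f , (X f , p f , sol) , |S|)
       (λ (S , (X , p , sol) , |S|) → (λ u → S u , X u , p u) , sol , |S|)
       (Π-searchable (×-searchable Bool-searchable (×-searchable Bool-searchable (any? t))) t
                     Certified Certified-resp Certified?)
  where
  Triple = Vertex t → Bool × Bool × Vertex t
  S X : Triple → Sub t
  S f = proj₁ ∘ f
  X f = proj₁ ∘ proj₂ ∘ f
  p : Triple → Vertex t → Vertex t
  p f = proj₂ ∘ proj₂ ∘ f
  Certified : Triple → Set
  Certified f = IsSolution t k (S f) (X f) (p f) × card (S f) ≡ n
  Certified-resp : Certified Respects _≗_
  Certified-resp f≗g (sol , |S|) =
    isSolution-cong (cong proj₁ ∘ f≗g) (cong (proj₁ ∘ proj₂) ∘ f≗g) (cong (proj₂ ∘ proj₂) ∘ f≗g) sol ,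
    trans (card-cong (cong proj₁ ∘ sym ∘ f≗g)) |S|
  Certified? : Decidable Certified
  Certified? f = isSolution? t k (S f) (X f) (p f) ×-dec card (S f) ℕ.≟ n

solution-parity : ∀ {k S} → Solution t k S → ∃ λ m → card S ≡ k + 2 * m
solution-parity {t} {k} {S} (X , p , sol) =
  let (m , |S∖X|≡2m) = matching-card-even matching
  in m , (begin
    card S                      ≡⟨ card-∩-∖ t S X ⟩
    card (S ∩ X) + card (S ∖ X) ≡⟨ cong₂ _+_ (trans (card-cong (∩-absorbs X⊆S)) card-X) |S∖X|≡2m ⟩
    k + 2 * m                   ∎)
  where
  open IsSolution sol
  open ≡-Reasoning

-- Exchanges

record Absorption (t : Tree) (X S : Sub t) (w : Vertex t) : Set where
  field
    S'        : Sub t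
    partner   : Vertex t → Vertex t
    S⊆S'      : S ⊆ S'
    matching  : PerfectMatching t (S' ∖ X) partner
    dominated : ∀ u → DominatedAt t (insert w S) u → DominatedAt t S' u
    card-S'   : card S' ≤ 2 + card S

-- Either w has a neighbour y outside S, and w, y join S matched to each other, or all
-- neighbours of w lie in S and w is dropped: S still dominates w, since a non-twin has a
-- neighbour, and whatever w dominated, since those vertices are in S.
absorb : ∀ {X S : Sub t} {p} w → X ⊆ S → PerfectMatching t (S ∖ X) p → ¬ T (S w) → Absorption t X S w
absorb {t} {X} {S} {p} w X⊆S pm ¬Sw
  with any? t (λ y → Adj t w y × ¬ T (S y)) (λ y → Adj? t w y ×-dec ¬? (T? (S y)))
... | yes (y , wy , ¬Sy) = record
  { S'        = insert y (insert w S)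
  ; partner   = link w y p
  ; S⊆S'      = λ u → ⊆-insert y (insert w S) u ∘ ⊆-insert w S u
  ; matching  = matching-cong (sym ∘ S'∖X≗) (λ _ → refl)
                              (matching-link pm (¬Sw ∘ ∖-⊆ S X w) (¬Sy ∘ ∖-⊆ S X y) wy)
  ; dominated = λ u → dominatedAt-mono (⊆-insert y (insert w S))
  ; card-S'   = ≤-reflexive (trans (card-insert y (insert w S) y∉) (cong suc (card-insert w S ¬Sw)))
  }
  where
  S'∖X≗ : insert y (insert w S) ∖ X ≗ insert y (insert w (S ∖ X))
  S'∖X≗ u = trans (insert-∖ {S = insert w S} y (¬Sy ∘ X⊆S y) u)
                  (update-cong y true (insert-∖ {S = S} w (¬Sw ∘ X⊆S w)) u)
  y∉ : ¬ T (insert w S y)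
  y∉ = ¬Sy ∘ ∈-insert⁻ w S (Adj⇒≢ wy ∘ sym)
... | no ∄y = record
  { S'        = S
  ; partner   = p
  ; S⊆S'      = λ _ Su → Su
  ; matching  = pm
  ; dominated = still-dominated
  ; card-S'   = m≤n+m (card S) 2
  }
  where
  neighbour∈S : ∀ {u} → Adj t w u → T (S u)
  neighbour∈S {u} wu = decidable-stable (T? (S u)) (λ ¬Su → ∄y (u , wu , ¬Su))
  still-dominated : ∀ u → DominatedAt t (insert w S) u → DominatedAt t S u
  still-dominated u D ¬TSu with u ≟ w | D ¬TSu
  ... | yes refl | _ =
    let (v , vu) = non-twin-has-neighbour t u ¬TSu in inj₂ (v , neighbour∈S (Adj-sym t vu) , vu)
  ... | no _     | inj₁ Su = inj₁ Su
  ... | no _     | inj₂ (v , Sv , vu) with v ≟ w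
  ...   | yes refl = inj₁ (neighbour∈S vu)
  ...   | no _     = inj₂ (v , Sv , vu)

Exchange : (t : Tree) → ℕ → ℕ → Set
Exchange t k k' = ∀ {S} → Solution t k S → ∃ λ S' → Solution t k' S' × card S' ≤ suc (card S)

-- x leaves X and, now unmatched, is absorbed anew.
solution-pred : ∀ {k} → Exchange t (suc k) k
solution-pred {t} {k} {S} (X , p , sol) = A.S' , (remove x X , A.partner , sol') , card-S'
  where
  open IsSolution sol
  x  = proj₁ (card-suc⇒nonempty t card-X)
  Xx = proj₂ (card-suc⇒nonempty t card-X)
  X'⊆S₀ : remove x X ⊆ remove x S
  X'⊆S₀ = ⊆-remove (∉-remove x X) (⊆-trans (remove-⊆ x X) X⊆S)
  module A = Absorption (absorb x X'⊆S₀ (matching-cong (sym ∘ remove-∖-remove Xx) (λ _ → refl) matching)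
                                        (∉-remove x S))
  sol' : IsSolution t k A.S' (remove x X) A.partner
  sol' = record
    { dominates = λ u → A.dominated u (dominatedAt-mono (⊆-insert-remove x S) (dominates u))
    ; X⊆S       = ⊆-trans X'⊆S₀ A.S⊆S'
    ; X⊆TS      = ⊆-trans (remove-⊆ x X) X⊆TS
    ; card-X    = suc-injective (trans (sym (card-remove x X Xx)) card-X)
    ; matching  = A.matching
    }
  card-S' : card A.S' ≤ suc (card S)
  card-S' = subst (λ n → card A.S' ≤ suc n) (sym (card-remove x S (X⊆S x Xx))) A.card-S'

twin-outside : ∀ t (X : Sub t) → card X < card (TS t) → ∃ λ u → T (TS t u) × ¬ T (X u)
twin-outside t X |X|<|TS| with any? t _ (λ u → T? (TS t u) ×-dec ¬? (T? (X u)))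
... | yes found = found
... | no ∄u     = ⊥-elim (<⇒≱ |X|<|TS| (card-mono t TS⊆X))
  where
  TS⊆X : TS t ⊆ X
  TS⊆X u TSu = decidable-stable (T? (X u)) (λ ¬Xu → ∄u (u , TSu , ¬Xu))

-- A twin u joins X. If u ∈ S, its partner w loses its match and is absorbed again.
solution-suc : ∀ {k} → k < card (TS t) → Exchange t k (suc k)
solution-suc {t} {k} k<|TS| {S} (X , p , sol) = extend (T? (S u))
  where
  open IsSolution sol
  u-spec = twin-outside t X (subst (_< card (TS t)) (sym card-X) k<|TS|)
  u   = proj₁ u-spec
  TSu = proj₁ (proj₂ u-spec)
  ¬Xu = proj₂ (proj₂ u-spec)
  card-X' : card (insert u X) ≡ suc k
  card-X' = trans (card-insert u X ¬Xu) (cong suc card-X)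
  extend : Dec (T (S u)) → ∃ λ S' → Solution t (suc k) S' × card S' ≤ suc (card S)
  extend (no ¬Su) = insert u S , (insert u X , p , sol') , ≤-reflexive (card-insert u S ¬Su)
    where
    sol' : IsSolution t (suc k) (insert u S) (insert u X) p
    sol' = record
      { dominates = λ v → dominatedAt-mono (⊆-insert u S) (dominates v)
      ; X⊆S       = insert-⊆ (insert-∋ u S) (⊆-trans X⊆S (⊆-insert u S))
      ; X⊆TS      = insert-⊆ TSu X⊆TS
      ; card-X    = card-X'
      ; matching  = matching-cong (sym ∘ insert-∖-insert ¬Su) (λ _ → refl) matching
      }
  extend (yes Su) = A.S' , (insert u X , A.partner , sol') , card-S'
    where
    u∈S∖X : T ((S ∖ X) u)
    u∈S∖X = ∈-∖⁺ {A = S} {X} Su ¬Xu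
    open Matched (matching u u∈S∖X)
    w = p u
    X'⊆S₀ : insert u X ⊆ remove w S
    X'⊆S₀ = insert-⊆ (∈-remove⁺ w S (Adj⇒≢ adjacent) Su) (⊆-remove (∈-∖⁻ {A = S} {X} partner∈) X⊆S)
    module A = Absorption (absorb w X'⊆S₀
      (matching-cong (sym ∘ remove-∖-insert w u) (λ _ → refl) (matching-remove-pair matching u∈S∖X))
      (∉-remove w S))
    sol' : IsSolution t (suc k) A.S' (insert u X) A.partner
    sol' = record
      { dominates = λ v → A.dominated v (dominatedAt-mono (⊆-insert-remove w S) (dominates v))
      ; X⊆S       = ⊆-trans X'⊆S₀ A.S⊆S'
      ; X⊆TS      = insert-⊆ TSu X⊆TS
      ; card-X    = card-X'
      ; matching  = A.matching
      }
    card-S' : card A.S' ≤ suc (card S)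
    card-S' = subst (λ n → card A.S' ≤ suc n) (sym (card-remove w S (∖-⊆ S X w partner∈))) A.card-S'

-- Existence of γ̂_k

∈-allVertices : ∀ t u → u ∈ allVertices t
∈-allVertices leaf         here      = Any.here refl
∈-allVertices (node a l r) (left x)  = ∈-++⁺ˡ (∈-map⁺ left (∈-allVertices l x))
∈-allVertices (node a l r) (right y) =
  ∈-++⁺ʳ (map left (allVertices l)) (∈-map⁺ right (∈-allVertices r y))

greedy-dominating : ∀ t (vs : List (Vertex t)) →
                    ∃₂ λ S p → TS t ⊆ S × PerfectMatching t (S ∖ TS t) p × All (DominatedAt t S) vs
greedy-dominating t [] = TS t , id , (λ _ TSu → TSu) , nothing-to-match , []
  where
  nothing-to-match : PerfectMatching t (TS t ∖ TS t) id
  nothing-to-match u u∈ = ⊥-elim (∈-∖⁻ {A = TS t} {TS t} u∈ (∖-⊆ (TS t) (TS t) u u∈))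
greedy-dominating t (y ∷ vs) with greedy-dominating t vs
... | S , p , TS⊆S , pm , doms with T? (S y)
...   | yes Sy = S , p , TS⊆S , pm , (λ _ → inj₁ Sy) ∷ doms
...   | no ¬Sy =
  A.S' , A.partner , ⊆-trans TS⊆S A.S⊆S' , A.matching ,
  A.dominated y (λ _ → inj₁ (insert-∋ y S)) ∷
  All.map (λ {u} → A.dominated u ∘ dominatedAt-mono (⊆-insert y S)) doms
  where module A = Absorption (absorb y TS⊆S pm ¬Sy)

solution-all-twins : ∀ t → ∃ (Solution t (card (TS t)))
solution-all-twins t =
  let (S , p , TS⊆S , pm , doms) = greedy-dominating t (allVertices t)
  in S , TS t , p , record
       { dominates = λ u → All.lookup doms (∈-allVertices t u)
       ; X⊆S       = TS⊆S
       ; X⊆TS      = λ _ TSu → TSu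
       ; card-X    = refl
       ; matching  = pm
       }

solution-exists : ∀ t {k} → k ≤ card (TS t) → ∃ (Solution t k)
solution-exists t {k} k≤|TS| = below (card (TS t) ∸ k) k (m∸n+n≡m k≤|TS|)
  where
  below : ∀ d k → d + k ≡ card (TS t) → ∃ (Solution t k)
  below zero    k refl = solution-all-twins t
  below (suc d) k eq   =
    let (S , sol)       = below d (suc k) (trans (+-suc d k) eq)
        (S' , sol' , _) = solution-pred sol
    in S' , sol'

least : ∀ {ℓ} {P : ℕ → Set ℓ} → Decidable P → ∀ {n} → P n → ∃ λ m → P m × (∀ {j} → P j → m ≤ j)
least {P = P} P? {n} Pn = [ id , (λ none → ⊥-elim (none ≤-refl Pn)) ] (search (suc n))
  where
  search : ∀ b → (∃ λ m → P m × (∀ {j} → P j → m ≤ j)) ⊎ (∀ {j} → j < b → ¬ P j)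
  search zero = inj₂ λ ()
  search (suc b) with search b
  ... | inj₁ found = inj₁ found
  ... | inj₂ none with P? b
  ...   | yes Pb = inj₁ (b , Pb , λ Pj → ≮⇒≥ (λ j<b → none j<b Pj))
  ...   | no ¬Pb = inj₂ λ j<1+b → [ none , (λ { refl → ¬Pb }) ] (m<1+n⇒m<n∨m≡n j<1+b)

gamma-exists : ∀ t {k} → k ≤ card (TS t) → ∃ (IsGammaHat t k)
gamma-exists t {k} k≤|TS| =
  let (S , sol) = solution-exists t k≤|TS|
      (g , feasible-g , minimal) = least feasible-of-size? (S , solution⇒feasible sol , refl)
  in g , feasible-g , λ S' F' → minimal (S' , F' , refl)
  where
  feasible-of-size? : Decidable (λ n → ∃ λ S → Feasible t k S × card S ≡ n)
  feasible-of-size? n =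
    map′ (λ (S , sol , |S|) → S , solution⇒feasible sol , |S|)
         (λ (S , F , |S|) → S , feasible⇒solution F , |S|)
         (solution-of-size? t k n)

gamma-step : ∀ {k k' g g'} → Exchange t k k' → IsGammaHat t k g → IsGammaHat t k' g' → g' ≤ suc g
gamma-step step ((S , F , |S|≡g) , _) (_ , minimal') =
  let (S' , sol' , |S'|≤1+|S|) = step (feasible⇒solution F)
  in ≤-trans (minimal' S' (solution⇒feasible sol')) (subst (λ n → card S' ≤ suc n) |S|≡g |S'|≤1+|S|)

gamma-parity : ∀ {k g} → IsGammaHat t k g → ∃ λ m → g ≡ k + 2 * m
gamma-parity ((S , F , |S|≡g) , _) =
  let (m , |S|≡k+2m) = solution-parity (feasible⇒solution F) in m , trans (sym |S|≡g) |S|≡k+2m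

gamma-suc-≢ : ∀ {k g g'} → IsGammaHat t k g → IsGammaHat t (suc k) g' → g ≢ g'
gamma-suc-≢ {k = k} γ γ' g≡g' =
  let (m , g≡k+2m)        = gamma-parity γ
      (m' , g'≡1+k+2m') = gamma-parity γ'
      k+2m≡k+[1+2m'] = trans (sym g≡k+2m) (trans g≡g' (trans g'≡1+k+2m' (sym (+-suc k (2 * m')))))
  in even≢odd m m' (+-cancelˡ-≡ k _ _ k+2m≡k+[1+2m'])

∣m-n∣≡1 : ∀ {m n} → n ≤ suc m → m ≤ suc n → m ≢ n → ∣ m - n ∣ ≡ 1
∣m-n∣≡1 {zero}        {zero}        _           _           m≢n = ⊥-elim (m≢n refl)
∣m-n∣≡1 {zero}        {suc zero}    _           _           _   = refl
∣m-n∣≡1 {zero}        {suc (suc n)} (s≤s ())    _           _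
∣m-n∣≡1 {suc zero}    {zero}        _           _           _   = refl
∣m-n∣≡1 {suc (suc m)} {zero}        _           (s≤s ())    _
∣m-n∣≡1 {suc m}       {suc n}       (s≤s n≤1+m) (s≤s m≤1+n) m≢n = ∣m-n∣≡1 n≤1+m m≤1+n (m≢n ∘ cong suc)

gamma-adjacent : ∀ {k g g'} → k < card (TS t) →
                 IsGammaHat t k g → IsGammaHat t (suc k) g' → ∣ g - g' ∣ ≡ 1
gamma-adjacent k<|TS| γ γ' =
  ∣m-n∣≡1 (gamma-step (solution-suc k<|TS|) γ γ') (gamma-step solution-pred γ' γ) (gamma-suc-≢ γ γ')

lemma4 : (a : Label) (l r : Tree) (k : ℕ) →
    k < card (TS (node a l r)) →
    ∃₂ λ g g' → IsGammaHat (node a l r) k g × IsGammaHat (node a l r) (suc k) g' × ∣ g - g' ∣ ≡ 1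
lemma4 a l r k k<|TS| =
  let (g , γ)   = gamma-exists (node a l r) (<⇒≤ k<|TS|)
      (g' , γ') = gamma-exists (node a l r) k<|TS|
  in g , g' , γ , γ' , gamma-adjacent k<|TS| γ γ'
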